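{- Let $p\ge3$, $n\ge 0$ be integers, let $\lambda\in\Gamma_p^n$ with $\lambda<\Delta(H_p^n)$, and let $\mu=f_{p,n}^{ -1}(\lambda)$. Then the number of edges $\{u,v\}$ of $H_p^n$ with $\deg(u)<\deg(v)=\lambda$ equals \[ \sum_{\nu=0}^{\mu}(p-\mu)(\mu-\nu)\,O_p^n(\nu\mid\mu). \]
   Context: For integers $p\ge 3$, $n\ge 0$, let $[p]_0=\{0,\dots,p-1\}$. The generalized Hanoi graph $H_p^n$ has vertex set $[p]_0^n$: a vertex $s=s_n\cdots s_1$ encodes a state of the Tower of Hanoi with $p$ pegs and $n$ discs of sizes $1<\dots<n$, disc $d$ lying on peg $s_d$. Two vertices are adjacent iff they have the form $\underline{s}\,i\,\overline{s}$ and $\underline{s}\,j\,\overline{s}$ with $i\ne j$, $\underline{s}\in[p]_0^{n-d}$, $\overline{s}\in([p]_0\setminus\{i,j\})^{d-1}$ for some $d$. The occupancy $o(s)$ is the number of pegs holding at least one disc; a peg is a singleton if it holds exactly one disc. Let $r=\min\{n,p\}$ and $f_{p,n}(\mu)=\binom p2-\binom{p-\mu}2$; every vertex $s$ has degree $f_{p,n}(o(s))$. $\Gamma_p^n=\{f_{p,n}(\mu):1\le\mu\le r\}$ is the set of vertex degrees, $\Delta(H_p^n)$ the maximum degree; for $\lambda<\Delta(H_p^n)$ in $\Gamma_p^n$ the preimage $f_{p,n}^{ -1}(\lambda)$ in $\{1,\dots,r\}$ is a single value. $O_p^n(\nu\mid\mu)$ is the number of states with exactly $\mu$ occupied pegs,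 exactly $\nu$ of which are singletons. -}

module Defs where

open import Data.Nat using (ℕ; zero; suc; _+_; _*_; _∸_; _⊔_; _⊓_; _<ᵇ_; _≡ᵇ_)
open import Data.Nat.Combinatorics using (_C_)
open import Data.Bool using (Bool; true; false; _∧_; not; if_then_else_)
open import Data.Fin using (Fin; toℕ)
open import Data.Fin.Properties using (_≟_)
open import Data.Vec using (Vec; []; _∷_; lookup)
open import Data.List using (List; []; _∷_; map; concatMap; foldr; upTo; allFin)
open import Data.Bool.ListAction using (all; any)
open import Data.Nat.ListAction using (sum)
open import Relation.Nullary.Decidable using (⌊_⌋)

-- A state s of H_p^n: disc d (d = 1..n) sits on peg  lookup s (disc index d-1).
-- Fin index i stands for the disc of size toℕ i + 1.
State : ℕ → ℕ → Set
State p n = Vec (Fin p) n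

allStates : (p n : ℕ) → List (State p n)
allStates p zero = [] ∷ []
allStates p (suc n) = concatMap (λ k → map (k ∷_) (allStates p n)) (allFin p)

count : {A : Set} → (A → Bool) → List A → ℕ
count P [] = 0
count P (x ∷ xs) = (if P x then 1 else 0) + count P xs

_==_ : {p : ℕ} → Fin p → Fin p → Bool
a == b = ⌊ a ≟ b ⌋

-- Adjacency in H_p^n: s = s̲ i s̄, t = s̲ j s̄ with i ≠ j at disc d,
-- identical on larger discs, and all smaller discs (s̄) avoid pegs i and j.
adj : {p n : ℕ} → State p n → State p n → Bool
adj {p} {n} s t = any moveAt (allFin n)
  where
  moveAt : Fin n → Bool
  moveAt d = not (lookup s d == lookup t d)
    ∧ all (λ e → if toℕ d <ᵇ toℕ e then lookup s e == lookup t e else true) (allFin n)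
    ∧ all (λ e → if toℕ e <ᵇ toℕ d
                 then (lookup s e == lookup t e) ∧ not (lookup s e == lookup s d)
                      ∧ not (lookup s e == lookup t d)
                 else true) (allFin n)

deg : {p n : ℕ} → State p n → ℕ
deg {p} {n} s = count (adj s) (allStates p n)

maxDeg : (p n : ℕ) → ℕ
maxDeg p n = foldr _⊔_ 0 (map deg (allStates p n))

discsOn : {p n : ℕ} → State p n → Fin p → ℕ
discsOn {p} {n} s k = count (λ d → lookup s d == k) (allFin n)

occ : {p n : ℕ} → State p n → ℕ
occ {p} s = count (λ k → 0 <ᵇ discsOn s k) (allFin p)

singletons : {p n : ℕ} → State p n → ℕ
singletons {p} s = count (λ k → discsOn s k ≡ᵇ 1) (allFin p)

O : (p n ν μ : ℕ) → ℕ
O p n ν μ = count (λ s → (occ s ≡ᵇ μ) ∧ (singletons s ≡ᵇ ν)) (allStates p n)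

f : (p n μ : ℕ) → ℕ
f p n μ = (p C 2) ∸ ((p ∸ μ) C 2)

r : (p n : ℕ) → ℕ
r p n = n ⊓ p

-- Counted as ordered pairs (u,v); the orientation is fixed by deg v < deg u,
-- so each such edge is counted exactly once.
edgesUp : (p n λ' : ℕ) → ℕ
edgesUp p n λ' = sum (map (λ u → count (λ v → adj u v ∧ (deg v <ᵇ deg u) ∧ (deg v ≡ᵇ λ'))
                                          (allStates p n))
                             (allStates p n))

rhs : (p n μ : ℕ) → ℕ
rhs p n μ = sum (map (λ ν → (p ∸ μ) * (μ ∸ ν) * O p n ν μ) (upTo (suc μ)))

module Submission where

open import Defs
open import Data.Bool using (Bool; true; false; _∧_; _∨_; not; if_then_else_; T)
open import Data.Bool.Properties using (∧-identityʳ; ∧-zeroʳ; ∧-assoc; ∧-inverseʳ; ∨-identityʳ; ∧-comm; T-≡; T-∧)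
open import Data.Bool.Solver using (module ∨-∧-Solver)
open import Data.Bool.ListAction using (all; any)
open import Data.Fin using (Fin; zero; suc; toℕ)
open import Data.Fin.Properties using (_≟_)
open import Data.List using (List; []; _∷_; _++_; [_]; map; concatMap; foldr; upTo; allFin; tabulate)
open import Data.List.Properties using (map-cong; map-tabulate; upTo-∷ʳ)
open import Data.Nat using (ℕ; zero; suc; _+_; _*_; _∸_; _⊔_; _<ᵇ_; _≡ᵇ_; _≤_; _<_; z≤n; s≤s; _<?_)
open import Data.Nat.ListAction using (sum)
open import Data.Nat.Tactic.RingSolver using (solve-∀)
open import Data.Nat.Combinatorics using (_C_; nC1≡n; nCk+nC[k+1]≡[n+1]C[k+1])
open import Data.Vec using ([]; _∷_; lookup)
open import Data.Nat.Properties hiding (_≟_)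
open import Function using (_∘_; id)
open import Function.Bundles using (Equivalence)
open import Relation.Binary.PropositionalEquality hiding ([_])
open import Relation.Nullary using (yes; no; contradiction)
open import Relation.Nullary.Reflects using (Reflects; fromEquivalence; det; _×-reflects_)
open import Relation.Binary using (tri<; tri≈; tri>)
open import Data.Product using (_×_; _,_)
open import Data.Sum using (inj₁; inj₂)
open import Algebra.Properties.CommutativeMonoid.Sum +-0-commutativeMonoid
  using (sum-cong-≗; ∑-distrib-+; sum-replicate-zero; sum-syntax) renaming (sum to ∑)
open import Algebra.Properties.CommutativeSemigroup +-commutativeSemigroup using (interchange; x∙yz≈y∙xz)

-- A vertex with o occupied pegs has degree C(o,2) + o(p − o): each pair of occupied pegs allows
-- the smaller of their top discs to move, and each occupied peg can send its top disc to any
-- empty peg.  This increases strictly with o up to o = p − 1 and takes the same value at p − 1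
-- and p, so λ < Δ forces μ ≤ p − 2, and an edge counted on the left joins a vertex v with μ
-- occupied pegs to a neighbour with more occupied pegs, i.e. moves the top disc of a peg holding
-- at least two discs onto an empty peg.  If ν of the occupied pegs of v are singletons there
-- are (μ − ν)(p − μ) such moves.  Both the degree and this count are obtained by recursion on
-- the smallest disc: either it moves, and all larger discs stay, or it stays and blocks its peg
-- for the moves of the larger discs.

χ : Bool → ℕ
χ b = if b then 1 else 0

module _ {A : Set} where

  count-cong : {P Q : A → Bool} → (∀ x → P x ≡ Q x) → ∀ xs → count P xs ≡ count Q xs
  count-cong P≗Q []       = refl
  count-cong P≗Q (x ∷ xs) = cong₂ (λ b m → χ b + m) (P≗Q x) (count-cong P≗Q xs)

  count-false : ∀ xs → count {A} (λ _ → false) xs ≡ 0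
  count-false []       = refl
  count-false (_ ∷ xs) = count-false xs

  count-∧ʳ : (P : A → Bool) (c : Bool) → ∀ xs → count (λ x → P x ∧ c) xs ≡ (if c then count P xs else 0)
  count-∧ʳ P true  xs = count-cong (λ x → ∧-identityʳ (P x)) xs
  count-∧ʳ P false xs = trans (count-cong (λ x → ∧-zeroʳ (P x)) xs) (count-false xs)

  count-++ : (P : A → Bool) → ∀ xs ys → count P (xs ++ ys) ≡ count P xs + count P ys
  count-++ P []       ys = refl
  count-++ P (x ∷ xs) ys = trans (cong (χ (P x) +_) (count-++ P xs ys)) (sym (+-assoc (χ (P x)) _ _))

  count≡sum-map-χ : (P : A → Bool) → ∀ xs → count P xs ≡ sum (map (χ ∘ P) xs)
  count≡sum-map-χ P []       = refl
  count≡sum-map-χ P (x ∷ xs) = cong (χ (P x) +_) (count≡sum-map-χ P xs)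

  sum-map-zero : (f : A → ℕ) → (∀ x → f x ≡ 0) → ∀ xs → sum (map f xs) ≡ 0
  sum-map-zero f f≗0 []       = refl
  sum-map-zero f f≗0 (x ∷ xs) = cong₂ _+_ (f≗0 x) (sum-map-zero f f≗0 xs)

  sum-map-+ : (f g : A → ℕ) → ∀ xs → sum (map (λ x → f x + g x) xs) ≡ sum (map f xs) + sum (map g xs)
  sum-map-+ f g []       = refl
  sum-map-+ f g (x ∷ xs) =
    trans (cong (f x + g x +_) (sum-map-+ f g xs)) (interchange (f x) (g x) _ _)

module _ {A B : Set} where

  count-map : (P : B → Bool) (g : A → B) → ∀ xs → count P (map g xs) ≡ count (P ∘ g) xs
  count-map P g []       = refl
  count-map P g (x ∷ xs) = cong (χ (P (g x)) +_) (count-map P g xs)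

  count-concatMap : (P : B → Bool) (g : A → List B) → ∀ xs →
    count P (concatMap g xs) ≡ sum (map (count P ∘ g) xs)
  count-concatMap P g []       = refl
  count-concatMap P g (x ∷ xs) =
    trans (count-++ P (g x) (concatMap g xs)) (cong (count P (g x) +_) (count-concatMap P g xs))

  sum-count-comm : (R : A → B → Bool) → ∀ xs ys →
    sum (map (λ x → count (R x) ys) xs) ≡ sum (map (λ y → count (λ x → R x y) xs) ys)
  sum-count-comm R []       ys = sym (sum-map-zero _ (λ _ → refl) ys)
  sum-count-comm R (x ∷ xs) ys = begin
    count (R x) ys + sum (map (λ x′ → count (R x′) ys) xs)
      ≡⟨ cong₂ _+_ (count≡sum-map-χ (R x) ys) (sum-count-comm R xs ys) ⟩
    sum (map (χ ∘ R x) ys) + sum (map (λ y → count (λ x′ → R x′ y) xs) ys)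
      ≡⟨ sum-map-+ (χ ∘ R x) (λ y → count (λ x′ → R x′ y) xs) ys ⟨
    sum (map (λ y → count (λ x′ → R x′ y) (x ∷ xs)) ys) ∎
    where open ≡-Reasoning

χ-<ᵇ-suc : ∀ k m → χ (k <ᵇ m) + χ (k ≡ᵇ m) ≡ χ (k <ᵇ suc m)
χ-<ᵇ-suc zero    zero    = refl
χ-<ᵇ-suc zero    (suc m) = refl
χ-<ᵇ-suc (suc k) zero    = refl
χ-<ᵇ-suc (suc k) (suc m) = χ-<ᵇ-suc k m

count-≡ᵇ-upTo : ∀ k m → count (k ≡ᵇ_) (upTo m) ≡ χ (k <ᵇ m)
count-≡ᵇ-upTo k zero    = refl
count-≡ᵇ-upTo k (suc m) = begin
  count (k ≡ᵇ_) (upTo (suc m))        ≡⟨ cong (count (k ≡ᵇ_)) (upTo-∷ʳ m) ⟨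
  count (k ≡ᵇ_) (upTo m ++ [ m ])     ≡⟨ count-++ (k ≡ᵇ_) (upTo m) [ m ] ⟩
  count (k ≡ᵇ_) (upTo m) + (χ (k ≡ᵇ m) + 0)
    ≡⟨ cong₂ _+_ (count-≡ᵇ-upTo k m) (+-identityʳ _) ⟩
  χ (k <ᵇ m) + χ (k ≡ᵇ m)             ≡⟨ χ-<ᵇ-suc k m ⟩
  χ (k <ᵇ suc m)                      ∎
  where open ≡-Reasoning

sum-map-*-χ-≡ᵇ : (c : ℕ → ℕ) (k : ℕ) → ∀ ns →
  sum (map (λ ν → c ν * χ (k ≡ᵇ ν)) ns) ≡ c k * count (k ≡ᵇ_) ns
sum-map-*-χ-≡ᵇ c k []       = sym (*-zeroʳ (c k))
sum-map-*-χ-≡ᵇ c k (ν ∷ ns) =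
  trans (cong₂ _+_ term (sum-map-*-χ-≡ᵇ c k ns)) (sym (*-distribˡ-+ (c k) _ _))
  where
  term : c ν * χ (k ≡ᵇ ν) ≡ c k * χ (k ≡ᵇ ν)
  term with k ≡ᵇ ν in k≡ᵇν
  ... | true  = cong (λ m → c m * 1) (sym (≡ᵇ⇒≡ k ν (subst T (sym k≡ᵇν) _)))
  ... | false = trans (*-zeroʳ (c ν)) (sym (*-zeroʳ (c k)))

module _ {A : Set} (c : ℕ → ℕ) (m : ℕ) where

  if≡sum-upTo : (b : Bool) (k : ℕ) → (T b → k < m) →
    (if b then c k else 0) ≡ sum (map (λ ν → c ν * χ (b ∧ (k ≡ᵇ ν))) (upTo m))
  if≡sum-upTo false k _   = sym (sum-map-zero _ (λ ν → *-zeroʳ (c ν)) (upTo m))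
  if≡sum-upTo true  k k<m = sym (begin
    sum (map (λ ν → c ν * χ (k ≡ᵇ ν)) (upTo m)) ≡⟨ sum-map-*-χ-≡ᵇ c k (upTo m) ⟩
    c k * count (k ≡ᵇ_) (upTo m)                ≡⟨ cong (c k *_) (count-≡ᵇ-upTo k m) ⟩
    c k * χ (k <ᵇ m)
      ≡⟨ cong (λ b → c k * χ b) (Equivalence.to T-≡ (<⇒<ᵇ (k<m _))) ⟩
    c k * 1                                     ≡⟨ *-identityʳ (c k) ⟩
    c k                                         ∎)
    where open ≡-Reasoning

  sum-if≡sum-fibres : (P : A → Bool) (g : A → ℕ) → (∀ x → T (P x) → g x < m) → ∀ xs →
    sum (map (λ x → if P x then c (g x) else 0) xs)
      ≡ sum (map (λ ν → c ν * count (λ x → P x ∧ (g x ≡ᵇ ν)) xs) (upTo m))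
  sum-if≡sum-fibres P g g<m []       = sym (sum-map-zero _ (λ ν → *-zeroʳ (c ν)) (upTo m))
  sum-if≡sum-fibres P g g<m (x ∷ xs) = begin
    (if P x then c (g x) else 0) + sum (map (λ x → if P x then c (g x) else 0) xs)
      ≡⟨ cong₂ _+_ (if≡sum-upTo (P x) (g x) (g<m x)) (sum-if≡sum-fibres P g g<m xs) ⟩
    sum (map (λ ν → c ν * χ (P x ∧ (g x ≡ᵇ ν))) (upTo m)) + sum (map (λ ν → c ν * fibre xs ν) (upTo m))
      ≡⟨ sum-map-+ _ _ (upTo m) ⟨
    sum (map (λ ν → c ν * χ (P x ∧ (g x ≡ᵇ ν)) + c ν * fibre xs ν) (upTo m))
      ≡⟨ cong sum (map-cong (λ ν → *-distribˡ-+ (c ν) _ _) (upTo m)) ⟨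
    sum (map (λ ν → c ν * fibre (x ∷ xs) ν) (upTo m)) ∎
    where
    open ≡-Reasoning
    fibre : List A → ℕ → ℕ
    fibre ys ν = count (λ y → P y ∧ (g y ≡ᵇ ν)) ys

+-cancelˡ-<ᵇ : ∀ c m n → (c + m <ᵇ c + n) ≡ (m <ᵇ n)
+-cancelˡ-<ᵇ zero    m n = refl
+-cancelˡ-<ᵇ (suc c) m n = +-cancelˡ-<ᵇ c m n

+-cancelʳ-<ᵇ : ∀ c m n → (m + c <ᵇ n + c) ≡ (m <ᵇ n)
+-cancelʳ-<ᵇ c m n rewrite +-comm m c | +-comm n c = +-cancelˡ-<ᵇ c m n

countFin : {p : ℕ} → (Fin p → Bool) → ℕ
countFin h = ∑ (χ ∘ h)

sum-tabulate : {n : ℕ} (g : Fin n → ℕ) → sum (tabulate g) ≡ ∑ g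
sum-tabulate {zero}  g = refl
sum-tabulate {suc n} g = cong (g zero +_) (sum-tabulate (g ∘ suc))

count-tabulate : {A : Set} {n : ℕ} (P : A → Bool) (g : Fin n → A) → count P (tabulate g) ≡ countFin (P ∘ g)
count-tabulate {n = zero}  P g = refl
count-tabulate {n = suc n} P g = cong (χ (P (g zero)) +_) (count-tabulate P (g ∘ suc))

==-refl : {p : ℕ} (x : Fin p) → (x == x) ≡ true
==-refl x with x ≟ x
... | yes _  = refl
... | no x≢x = contradiction refl x≢x

==-sym : {p : ℕ} (x y : Fin p) → (x == y) ≡ (y == x)
==-sym x y with x ≟ y | y ≟ x
... | yes _   | yes _   = refl
... | no _    | no _    = refl
... | yes x≡y | no y≢x  = contradiction (sym x≡y) y≢x
... | no x≢y  | yes y≡x = contradiction (sym y≡x) x≢y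

==-suc : {p : ℕ} (x y : Fin p) → (Fin.suc x == Fin.suc y) ≡ (x == y)
==-suc x y with x ≟ y
... | yes _ = refl
... | no _  = refl

∑-pick : {p : ℕ} (x : Fin p) (h : Fin p → ℕ) → ∑ h ≡ h x + ∑ (λ k → if x == k then 0 else h k)
∑-pick zero    h = refl
∑-pick (suc x) h = begin
  h zero + ∑ (h ∘ suc)                                           ≡⟨ cong (h zero +_) (∑-pick x (h ∘ suc)) ⟩
  h zero + (h (suc x) + ∑ (λ k → if x == k then 0 else h (suc k))) ≡⟨ x∙yz≈y∙xz (h zero) (h (suc x)) _ ⟩
  h (suc x) + (h zero + ∑ (λ k → if x == k then 0 else h (suc k)))
    ≡⟨ cong (λ z → h (suc x) + (h zero + z))
            (sum-cong-≗ (λ k → cong (λ b → if b then 0 else h (suc k)) (==-suc x k))) ⟨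
  h (suc x) + ∑ (λ k → if suc x == k then 0 else h k)            ∎
  where
  open ≡-Reasoning

countFin-pick : {p : ℕ} (x : Fin p) (h : Fin p → Bool) →
  countFin h ≡ χ (h x) + countFin (λ k → h k ∧ not (x == k))
countFin-pick x h = trans (∑-pick x (χ ∘ h)) (cong (χ (h x) +_) (sum-cong-≗ drop-x))
  where
  drop-x : ∀ k → (if x == k then 0 else χ (h k)) ≡ χ (h k ∧ not (x == k))
  drop-x k with x == k
  ... | true  = cong χ (sym (∧-zeroʳ (h k)))
  ... | false = cong χ (sym (∧-identityʳ (h k)))

countFin-false : {p : ℕ} → countFin {p} (λ _ → false) ≡ 0
countFin-false {p} = sum-replicate-zero p

countFin-∧ˡ : {p : ℕ} (c : Bool) (h : Fin p → Bool) →
  countFin (λ k → c ∧ h k) ≡ (if c then countFin h else 0)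
countFin-∧ˡ     true  h = refl
countFin-∧ˡ {p} false h = countFin-false {p}

countFin-split : {p : ℕ} {g h u : Fin p → Bool} → (∀ k → χ (g k) + χ (h k) ≡ χ (u k)) →
  countFin g + countFin h ≡ countFin u
countFin-split {g = g} {h} g+h≡u = trans (sym (∑-distrib-+ (χ ∘ g) (χ ∘ h))) (sum-cong-≗ g+h≡u)

countFin-true : {p : ℕ} → countFin {p} (λ _ → true) ≡ p
countFin-true {zero}  = refl
countFin-true {suc p} = cong suc (countFin-true {p})

countFin-≤ : {p : ℕ} (h : Fin p → Bool) → countFin h ≤ p
countFin-≤ h = subst (countFin h ≤_)
  (trans (countFin-split (λ k → χ-complement (h k))) countFin-true) (m≤m+n _ _)
  where
  χ-complement : ∀ b → χ b + χ (not b) ≡ 1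
  χ-complement true  = refl
  χ-complement false = refl

allᶠ : {n : ℕ} → (Fin n → Bool) → Bool
allᶠ {zero}  h = true
allᶠ {suc n} h = h zero ∧ allᶠ (h ∘ suc)

anyᶠ : {n : ℕ} → (Fin n → Bool) → Bool
anyᶠ {zero}  h = false
anyᶠ {suc n} h = h zero ∨ anyᶠ (h ∘ suc)

module _ {A : Set} where

  all-tabulate : {n : ℕ} (P : A → Bool) (g : Fin n → A) → all P (tabulate g) ≡ allᶠ (P ∘ g)
  all-tabulate {zero}  P g = refl
  all-tabulate {suc n} P g = cong (P (g zero) ∧_) (all-tabulate P (g ∘ suc))

  any-tabulate : {n : ℕ} (P : A → Bool) (g : Fin n → A) → any P (tabulate g) ≡ anyᶠ (P ∘ g)
  any-tabulate {zero}  P g = refl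
  any-tabulate {suc n} P g = cong (P (g zero) ∨_) (any-tabulate P (g ∘ suc))

anyᶠ-cong : {n : ℕ} {g h : Fin n → Bool} → (∀ d → g d ≡ h d) → anyᶠ g ≡ anyᶠ h
anyᶠ-cong {zero}  g≗h = refl
anyᶠ-cong {suc n} g≗h = cong₂ _∨_ (g≗h zero) (anyᶠ-cong (g≗h ∘ suc))

anyᶠ-∧ˡ : {n : ℕ} (c : Bool) (h : Fin n → Bool) → anyᶠ (λ d → c ∧ h d) ≡ c ∧ anyᶠ h
anyᶠ-∧ˡ     true  h = refl
anyᶠ-∧ˡ {n} false h = anyᶠ-false {n}
  where
  anyᶠ-false : {n : ℕ} → anyᶠ {n} (λ _ → false) ≡ false
  anyᶠ-false {zero}  = refl
  anyᶠ-false {suc n} = anyᶠ-false {n}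

allᶠ-true : {n : ℕ} → allᶠ {n} (λ _ → true) ≡ true
allᶠ-true {zero}  = refl
allᶠ-true {suc n} = allᶠ-true {n}

-- The degree function C(o,2) + o(p − o)

C2-suc : ∀ o → suc o C 2 ≡ o + o C 2
C2-suc o = trans (sym (nCk+nC[k+1]≡[n+1]C[k+1] o 1)) (cong (_+ o C 2) (nC1≡n o))

C2+*-step : ∀ b o e → o C 2 + o * e + (if b then o + e else 0) ≡ (χ b + o) C 2 + (χ b + o) * e
C2+*-step false o e = +-identityʳ _
C2+*-step true  o e = trans (arith (o C 2) o e) (cong (_+ suc o * e) (sym (C2-suc o)))
  where
  arith : ∀ c o e → c + o * e + (o + e) ≡ (o + c) + suc o * e
  arith = solve-∀

hanoiDegree : ℕ → ℕ → ℕ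
hanoiDegree p o = o C 2 + o * (p ∸ o)

C2-+ : ∀ a e → (a + e) C 2 ≡ a C 2 + a * e + e C 2
C2-+ zero    e = refl
C2-+ (suc a) e = begin
  suc (a + e) C 2                 ≡⟨ C2-suc (a + e) ⟩
  a + e + (a + e) C 2             ≡⟨ cong (a + e +_) (C2-+ a e) ⟩
  a + e + (a C 2 + a * e + e C 2) ≡⟨ arith a e (a C 2) (e C 2) ⟩
  (a + a C 2) + suc a * e + e C 2 ≡⟨ cong (λ c → c + suc a * e + e C 2) (C2-suc a) ⟨
  suc a C 2 + suc a * e + e C 2   ∎
  where
  open ≡-Reasoning
  arith : ∀ a e c d → a + e + (c + a * e + d) ≡ (a + c) + suc a * e + d
  arith = solve-∀

f≡hanoiDegree : ∀ {p μ} n → μ ≤ p → f p n μ ≡ hanoiDegree p μ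
f≡hanoiDegree {p} {μ} n μ≤p = begin
  p C 2 ∸ (p ∸ μ) C 2                        ≡⟨ cong (λ q → q C 2 ∸ (p ∸ μ) C 2) (m+[n∸m]≡n μ≤p) ⟨
  (μ + (p ∸ μ)) C 2 ∸ (p ∸ μ) C 2            ≡⟨ cong (_∸ (p ∸ μ) C 2) (C2-+ μ (p ∸ μ)) ⟩
  hanoiDegree p μ + (p ∸ μ) C 2 ∸ (p ∸ μ) C 2 ≡⟨ m+n∸n≡m (hanoiDegree p μ) ((p ∸ μ) C 2) ⟩
  hanoiDegree p μ                            ∎
  where open ≡-Reasoning

hanoiDegree-suc : ∀ {p o} → o < p → hanoiDegree p (suc o) ≡ hanoiDegree p o + (p ∸ suc o)
hanoiDegree-suc {p} {o} o<p = begin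
  suc o C 2 + suc o * (p ∸ suc o)               ≡⟨ cong (_+ suc o * (p ∸ suc o)) (C2-suc o) ⟩
  o + o C 2 + suc o * (p ∸ suc o)               ≡⟨ arith (o C 2) o (p ∸ suc o) ⟩
  o C 2 + o * suc (p ∸ suc o) + (p ∸ suc o)
    ≡⟨ cong (λ e → o C 2 + o * e + (p ∸ suc o)) (+-∸-assoc 1 o<p) ⟨
  o C 2 + o * (p ∸ o) + (p ∸ suc o)             ∎
  where
  open ≡-Reasoning
  arith : ∀ c o e → o + c + suc o * e ≡ c + o * suc e + e
  arith = solve-∀

hanoiDegree-mono-≤ : ∀ {p a b} → a ≤ b → b ≤ p → hanoiDegree p a ≤ hanoiDegree p b
hanoiDegree-mono-≤ {b = zero}  z≤n _ = ≤-refl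
hanoiDegree-mono-≤ {p} {a} {suc b} a≤sb sb≤p with m≤n⇒m<n∨m≡n a≤sb
... | inj₂ refl     = ≤-refl
... | inj₁ (s≤s a≤b) = begin
  hanoiDegree p a                  ≤⟨ hanoiDegree-mono-≤ a≤b (<⇒≤ sb≤p) ⟩
  hanoiDegree p b                  ≤⟨ m≤m+n _ _ ⟩
  hanoiDegree p b + (p ∸ suc b)    ≡⟨ hanoiDegree-suc sb≤p ⟨
  hanoiDegree p (suc b)            ∎
  where open ≤-Reasoning

hanoiDegree-mono-< : ∀ {p a b} → suc a < p → a < b → b ≤ p → hanoiDegree p a < hanoiDegree p b
hanoiDegree-mono-< {p} {a} {b} sa<p a<b b≤p = begin-strict
  hanoiDegree p a                  <⟨ m<m+n _ (m<n⇒0<n∸m sa<p) ⟩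
  hanoiDegree p a + (p ∸ suc a)    ≡⟨ hanoiDegree-suc (<⇒≤ sa<p) ⟨
  hanoiDegree p (suc a)            ≤⟨ hanoiDegree-mono-≤ a<b b≤p ⟩
  hanoiDegree p b                  ∎
  where open ≤-Reasoning

hanoiDegree-top : ∀ {p μ} → p ≤ suc μ → μ ≤ p → hanoiDegree p p ≤ hanoiDegree p μ
hanoiDegree-top {p} {μ} p≤sμ μ≤p with m≤n⇒m<n∨m≡n μ≤p
... | inj₂ refl = ≤-refl
... | inj₁ μ<p  = begin
  hanoiDegree p p              ≡⟨ cong (hanoiDegree p) (≤-antisym p≤sμ μ<p) ⟩
  hanoiDegree p (suc μ)        ≡⟨ hanoiDegree-suc μ<p ⟩
  hanoiDegree p μ + (p ∸ suc μ) ≡⟨ cong (λ k → hanoiDegree p μ + (p ∸ k)) (≤-antisym p≤sμ μ<p) ⟨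
  hanoiDegree p μ + (p ∸ p)    ≡⟨ cong (hanoiDegree p μ +_) (n∸n≡0 p) ⟩
  hanoiDegree p μ + 0          ≡⟨ +-identityʳ _ ⟩
  hanoiDegree p μ              ∎
  where open ≤-Reasoning

hanoiDegree-injective : ∀ {p a μ} → suc μ < p → a ≤ p → hanoiDegree p a ≡ hanoiDegree p μ → a ≡ μ
hanoiDegree-injective {p} {a} {μ} sμ<p a≤p eq with <-cmp a μ
... | tri< a<μ _ _ =
  contradiction eq (<⇒≢ (hanoiDegree-mono-< (<-trans (s≤s a<μ) sμ<p) a<μ (<⇒≤ (<-trans (n<1+n μ) sμ<p))))
... | tri≈ _ a≡μ _ = a≡μ
... | tri> _ _ μ<a = contradiction (sym eq) (<⇒≢ (hanoiDegree-mono-< sμ<p μ<a a≤p))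

degree-comparison : ∀ {p μ a b} → suc μ < p → a ≤ p → b ≤ p →
  ((hanoiDegree p a <ᵇ hanoiDegree p b) ∧ (hanoiDegree p a ≡ᵇ hanoiDegree p μ)) ≡ ((a <ᵇ b) ∧ (a ≡ᵇ μ))
degree-comparison {p} {μ} {a} {b} sμ<p a≤p b≤p =
  det (fromEquivalence sound complete) (<ᵇ-reflects-< a b ×-reflects ≡ᵇ-reflects a μ)
  where
  ≡ᵇ-reflects : ∀ m n → Reflects (m ≡ n) (m ≡ᵇ n)
  ≡ᵇ-reflects m n = fromEquivalence (≡ᵇ⇒≡ m n) (≡⇒≡ᵇ m n)
  D : ℕ → ℕ
  D = hanoiDegree p
  sound : T ((D a <ᵇ D b) ∧ (D a ≡ᵇ D μ)) → a < b × a ≡ μ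
  sound t with Equivalence.to T-∧ t
  ... | lt , eq = ≰⇒> (λ b≤a → <⇒≱ (<ᵇ⇒< _ _ lt) (hanoiDegree-mono-≤ b≤a a≤p))
                , hanoiDegree-injective sμ<p a≤p (≡ᵇ⇒≡ _ _ eq)
  complete : a < b × a ≡ μ → T ((D a <ᵇ D b) ∧ (D a ≡ᵇ D μ))
  complete (a<b , refl) = Equivalence.from T-∧ (<⇒<ᵇ (hanoiDegree-mono-< sμ<p a<b b≤p) , ≡⇒≡ᵇ (D μ) _ refl)

module _ {p : ℕ} where

  infix 4 _==ⱽ_
  _==ⱽ_ : {n : ℕ} → State p n → State p n → Bool
  []      ==ⱽ []      = true
  (x ∷ s) ==ⱽ (y ∷ t) = (x == y) ∧ (s ==ⱽ t)

  ==ⱽ-sound : {n : ℕ} (s t : State p n) → (s ==ⱽ t) ≡ true → s ≡ t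
  ==ⱽ-sound []      []      _ = refl
  ==ⱽ-sound (x ∷ s) (y ∷ t) s==t with x ≟ y
  ... | yes refl = cong (x ∷_) (==ⱽ-sound s t s==t)

  ==ⱽ-sym : {n : ℕ} (s t : State p n) → (s ==ⱽ t) ≡ (t ==ⱽ s)
  ==ⱽ-sym []      []      = refl
  ==ⱽ-sym (x ∷ s) (y ∷ t) = cong₂ _∧_ (==-sym x y) (==ⱽ-sym s t)

  count-allStates-suc : {n : ℕ} (P : State p (suc n) → Bool) →
    count P (allStates p (suc n)) ≡ ∑[ y < p ] count (λ t → P (y ∷ t)) (allStates p n)
  count-allStates-suc {n} P = begin
    count P (concatMap (λ y → map (y ∷_) (allStates p n)) (allFin p))
      ≡⟨ count-concatMap P (λ y → map (y ∷_) (allStates p n)) (allFin p) ⟩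
    sum (map (λ y → count P (map (y ∷_) (allStates p n))) (allFin p))
      ≡⟨ cong sum (map-cong (λ y → count-map P (y ∷_) (allStates p n)) (allFin p)) ⟩
    sum (map (λ y → count (λ t → P (y ∷ t)) (allStates p n)) (tabulate id))
      ≡⟨ cong sum (map-tabulate id row) ⟩
    sum (tabulate row)
      ≡⟨ sum-tabulate row ⟩
    ∑[ y < p ] count (λ t → P (y ∷ t)) (allStates p n) ∎
    where
    open ≡-Reasoning
    row : Fin p → ℕ
    row y = count (λ t → P (y ∷ t)) (allStates p n)

  count-==ⱽ-one : {n : ℕ} (s : State p n) → count (s ==ⱽ_) (allStates p n) ≡ 1
  count-==ⱽ-one []              = refl
  count-==ⱽ-one {suc n} (x ∷ s) = begin
    count ((x ∷ s) ==ⱽ_) (allStates p (suc n))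
      ≡⟨ count-allStates-suc ((x ∷ s) ==ⱽ_) ⟩
    ∑[ y < p ] count (λ t → (x == y) ∧ (s ==ⱽ t)) (allStates p n)
      ≡⟨ sum-cong-≗ (λ y → count-∧ˡ (x == y)) ⟩
    countFin (x ==_)
      ≡⟨ countFin-pick x (x ==_) ⟩
    χ (x == x) + countFin (λ k → (x == k) ∧ not (x == k))
      ≡⟨ cong₂ _+_ (cong χ (==-refl x)) (sum-cong-≗ (λ k → cong χ (∧-inverseʳ (x == k)))) ⟩
    1 + countFin {p} (λ _ → false)
      ≡⟨ cong suc (countFin-false {p}) ⟩
    1 ∎
    where
    open ≡-Reasoning
    count-∧ˡ : (c : Bool) → count (λ t → c ∧ (s ==ⱽ t)) (allStates p n) ≡ χ c
    count-∧ˡ true  = count-==ⱽ-one s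
    count-∧ˡ false = count-false (allStates p n)

  count-==ⱽ : {n : ℕ} (s : State p n) (Q : State p n → Bool) →
    count (λ t → (s ==ⱽ t) ∧ Q t) (allStates p n) ≡ χ (Q s)
  count-==ⱽ {n} s Q = begin
    count (λ t → (s ==ⱽ t) ∧ Q t) (allStates p n) ≡⟨ count-cong Q-at-s (allStates p n) ⟩
    count (λ t → (s ==ⱽ t) ∧ Q s) (allStates p n) ≡⟨ count-∧ʳ (s ==ⱽ_) (Q s) (allStates p n) ⟩
    (if Q s then count (s ==ⱽ_) (allStates p n) else 0)
      ≡⟨ cong (λ m → if Q s then m else 0) (count-==ⱽ-one s) ⟩
    χ (Q s) ∎
    where
    open ≡-Reasoning
    Q-at-s : ∀ t → ((s ==ⱽ t) ∧ Q t) ≡ ((s ==ⱽ t) ∧ Q s)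
    Q-at-s t with s ==ⱽ t in s==t
    ... | true  = cong Q (sym (==ⱽ-sound s t s==t))
    ... | false = refl

  discsOn-cons : {n : ℕ} (x : Fin p) (s : State p n) (k : Fin p) →
    discsOn (x ∷ s) k ≡ χ (x == k) + discsOn s k
  discsOn-cons x s k = trans (count-tabulate (λ d → lookup (x ∷ s) d == k) id)
    (cong (χ (x == k) +_) (sym (count-tabulate (λ d → lookup s d == k) id)))

-- Adjacency by recursion on the smallest disc

module _ {p : ℕ} where

  ==ⱽ-allᶠ : {n : ℕ} (s t : State p n) → (s ==ⱽ t) ≡ allᶠ (λ e → lookup s e == lookup t e)
  ==ⱽ-allᶠ []      []      = refl
  ==ⱽ-allᶠ (x ∷ s) (y ∷ t) = cong ((x == y) ∧_) (==ⱽ-allᶠ s t)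

  allPegs : Fin p → Bool
  allPegs _ = true

  _∖_ : (Fin p → Bool) → Fin p → Fin p → Bool
  (F ∖ x) k = F k ∧ not (x == k)

  -- The head of a state is its smallest disc.  adjOn F s t says that s and t differ by one
  -- move of a disc of s, when the pegs outside F already carry discs smaller than all of s.
  adjOn : {n : ℕ} → (Fin p → Bool) → State p n → State p n → Bool
  adjOn F []      []      = false
  adjOn F (x ∷ s) (y ∷ t) = if x == y then adjOn (F ∖ x) s t else (s ==ⱽ t) ∧ (F x ∧ F y)

  -- moveOn allPegs s t d is the condition in the definition of adj for a move of disc d.
  agreeAbove clearBelow : {n : ℕ} → State p n → State p n → Fin n → Bool
  agreeAbove s t d = allᶠ (λ e → if toℕ d <ᵇ toℕ e then lookup s e == lookup t e else true)
  clearBelow s t d = allᶠ (λ e → if toℕ e <ᵇ toℕ d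
                                 then (lookup s e == lookup t e) ∧ not (lookup s e == lookup s d)
                                      ∧ not (lookup s e == lookup t d)
                                 else true)

  moveOn : {n : ℕ} → (Fin p → Bool) → State p n → State p n → Fin n → Bool
  moveOn F s t d = not (lookup s d == lookup t d)
    ∧ (agreeAbove s t d ∧ ((F (lookup s d) ∧ F (lookup t d)) ∧ clearBelow s t d))

  moveOn-zero : {n : ℕ} (F : Fin p → Bool) (x y : Fin p) (s t : State p n) →
    moveOn F (x ∷ s) (y ∷ t) zero ≡ not (x == y) ∧ ((s ==ⱽ t) ∧ (F x ∧ F y))
  moveOn-zero {n} F x y s t = cong₂ (λ a b → not (x == y) ∧ (a ∧ b)) (sym (==ⱽ-allᶠ s t))
    (trans (cong ((F x ∧ F y) ∧_) (allᶠ-true {n})) (∧-identityʳ _))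

  moveOn-suc : {n : ℕ} (F : Fin p → Bool) (x y : Fin p) (s t : State p n) (d : Fin n) →
    moveOn F (x ∷ s) (y ∷ t) (suc d) ≡ (x == y) ∧ moveOn (F ∖ x) s t d
  moveOn-suc F x y s t d = ∧-shuffle (not (lookup s d == lookup t d)) (agreeAbove s t d)
    (F (lookup s d)) (F (lookup t d)) (not (x == lookup s d)) (not (x == lookup t d))
    (clearBelow s t d) (x == y)
    where
    open ∨-∧-Solver
    ∧-shuffle : ∀ a b c d e f g h →
      a ∧ (b ∧ ((c ∧ d) ∧ ((h ∧ (e ∧ f)) ∧ g))) ≡ h ∧ (a ∧ (b ∧ (((c ∧ e) ∧ (d ∧ f)) ∧ g)))
    ∧-shuffle = solve 8 (λ a b c d e f g h →
      a :* (b :* ((c :* d) :* ((h :* (e :* f)) :* g)))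
        := h :* (a :* (b :* (((c :* e) :* (d :* f)) :* g)))) refl

  anyᶠ-moveOn : {n : ℕ} (F : Fin p → Bool) (s t : State p n) → anyᶠ (moveOn F s t) ≡ adjOn F s t
  anyᶠ-moveOn F []      []      = refl
  anyᶠ-moveOn F (x ∷ s) (y ∷ t) = begin
    moveOn F (x ∷ s) (y ∷ t) zero ∨ anyᶠ (moveOn F (x ∷ s) (y ∷ t) ∘ suc)
      ≡⟨ cong₂ _∨_ (moveOn-zero F x y s t) (anyᶠ-cong (moveOn-suc F x y s t)) ⟩
    (not (x == y) ∧ move) ∨ anyᶠ (λ d → (x == y) ∧ moveOn (F ∖ x) s t d)
      ≡⟨ cong ((not (x == y) ∧ move) ∨_) (anyᶠ-∧ˡ (x == y) (moveOn (F ∖ x) s t)) ⟩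
    (not (x == y) ∧ move) ∨ ((x == y) ∧ anyᶠ (moveOn (F ∖ x) s t))
      ≡⟨ cong (λ a → (not (x == y) ∧ move) ∨ ((x == y) ∧ a)) (anyᶠ-moveOn (F ∖ x) s t) ⟩
    (not (x == y) ∧ move) ∨ ((x == y) ∧ adjOn (F ∖ x) s t)
      ≡⟨ ∨-as-if (x == y) ⟩
    adjOn F (x ∷ s) (y ∷ t) ∎
    where
    open ≡-Reasoning
    move : Bool
    move = (s ==ⱽ t) ∧ (F x ∧ F y)
    ∨-as-if : ∀ b {a m} → (not b ∧ m) ∨ (b ∧ a) ≡ (if b then a else m)
    ∨-as-if true  = refl
    ∨-as-if false = ∨-identityʳ _

  adj≡adjOn-allPegs : {n : ℕ} (s t : State p n) → adj s t ≡ adjOn allPegs s t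
  adj≡adjOn-allPegs {n} s t = begin
    adj s t
      ≡⟨ any-tabulate moveAt id ⟩
    anyᶠ moveAt
      ≡⟨ anyᶠ-cong (λ d → cong₂ (λ a b → not (lookup s d == lookup t d) ∧ (a ∧ b))
                             (all-tabulate (above d) id) (all-tabulate (below d) id)) ⟩
    anyᶠ (moveOn allPegs s t)
      ≡⟨ anyᶠ-moveOn allPegs s t ⟩
    adjOn allPegs s t ∎
    where
    open ≡-Reasoning
    above below : Fin n → Fin n → Bool
    above d e = if toℕ d <ᵇ toℕ e then lookup s e == lookup t e else true
    below d e = if toℕ e <ᵇ toℕ d
                then (lookup s e == lookup t e) ∧ not (lookup s e == lookup s d)
                     ∧ not (lookup s e == lookup t d)
                else true
    moveAt : Fin n → Bool
    moveAt d = not (lookup s d == lookup t d) ∧ (all (above d) (allFin n) ∧ all (below d) (allFin n))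

  adjOn-sym : {n : ℕ} (F : Fin p → Bool) (s t : State p n) → adjOn F s t ≡ adjOn F t s
  adjOn-sym F []      []      = refl
  adjOn-sym F (x ∷ s) (y ∷ t) with x ≟ y | y ≟ x
  ... | yes refl | yes _   = adjOn-sym (F ∖ x) s t
  ... | no _     | no _    = cong₂ _∧_ (==ⱽ-sym s t) (∧-comm (F x) (F y))
  ... | yes x≡y  | no y≢x  = contradiction (sym x≡y) y≢x
  ... | no x≢y   | yes y≡x = contradiction (sym y≡x) x≢y

  adjOn-discsOn : {n : ℕ} (F : Fin p → Bool) (s t : State p n) (k : Fin p) →
    adjOn F s t ≡ true → F k ≡ false → discsOn s k ≡ discsOn t k
  adjOn-discsOn F []      []      k ()  Fk
  adjOn-discsOn F (x ∷ s) (y ∷ t) k s~t Fk with x ≟ y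
  ... | yes refl = begin
    discsOn (x ∷ s) k          ≡⟨ discsOn-cons x s k ⟩
    χ (x == k) + discsOn s k   ≡⟨ cong (χ (x == k) +_) (adjOn-discsOn (F ∖ x) s t k s~t (cong (_∧ _) Fk)) ⟩
    χ (x == k) + discsOn t k   ≡⟨ discsOn-cons x t k ⟨
    discsOn (x ∷ t) k          ∎
    where open ≡-Reasoning
  ... | no _ with s ==ⱽ t in s==t | F x in Fx | F y in Fy
  ... | true | true | true rewrite ==ⱽ-sound s t s==t = begin
    discsOn (x ∷ t) k          ≡⟨ discsOn-cons x t k ⟩
    χ (x == k) + discsOn t k   ≡⟨ cong (λ b → χ b + discsOn t k) (trans (not-k Fx) (sym (not-k Fy))) ⟩
    χ (y == k) + discsOn t k   ≡⟨ discsOn-cons y t k ⟨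
    discsOn (y ∷ t) k          ∎
    where
    open ≡-Reasoning
    not-k : {z : Fin p} → F z ≡ true → (z == k) ≡ false
    not-k {z} Fz with z ≟ k
    ... | yes refl = contradiction (trans (sym Fz) Fk) λ ()
    ... | no _     = refl

  adjOn-stay : {n : ℕ} (F : Fin p → Bool) (x : Fin p) (s t : State p n) →
    adjOn F (x ∷ s) (x ∷ t) ≡ adjOn (F ∖ x) s t
  adjOn-stay F x s t = cong (λ b → if b then adjOn (F ∖ x) s t else (s ==ⱽ t) ∧ (F x ∧ F x)) (==-refl x)

  count-adjOn-cons : {n : ℕ} (F : Fin p → Bool) (x : Fin p) (s : State p n) (Q : State p (suc n) → Bool) →
    count (λ t → adjOn F (x ∷ s) t ∧ Q t) (allStates p (suc n))
      ≡ count (λ t → adjOn (F ∖ x) s t ∧ Q (x ∷ t)) (allStates p n)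
        + countFin (λ y → not (x == y) ∧ ((F x ∧ F y) ∧ Q (y ∷ s)))
  count-adjOn-cons {n} F x s Q = begin
    count (λ t → adjOn F (x ∷ s) t ∧ Q t) (allStates p (suc n))
      ≡⟨ count-allStates-suc (λ t → adjOn F (x ∷ s) t ∧ Q t) ⟩
    ∑ row
      ≡⟨ ∑-pick x row ⟩
    row x + ∑ (λ y → if x == y then 0 else row y)
      ≡⟨ cong₂ _+_ (count-cong (λ t → cong (_∧ Q (x ∷ t)) (adjOn-stay F x s t)) (allStates p n))
                   (sum-cong-≗ row-y) ⟩
    count (λ t → adjOn (F ∖ x) s t ∧ Q (x ∷ t)) (allStates p n)
      + countFin (λ y → not (x == y) ∧ ((F x ∧ F y) ∧ Q (y ∷ s))) ∎
    where
    open ≡-Reasoning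
    row : Fin p → ℕ
    row y = count (λ t → adjOn F (x ∷ s) (y ∷ t) ∧ Q (y ∷ t)) (allStates p n)
    row-y : ∀ y → (if x == y then 0 else row y) ≡ χ (not (x == y) ∧ ((F x ∧ F y) ∧ Q (y ∷ s)))
    row-y y with x == y in x==y
    ... | true  = refl
    ... | false = trans (count-cong (λ t → ∧-assoc (s ==ⱽ t) _ _) (allStates p n))
                        (count-==ⱽ s (λ t → (F x ∧ F y) ∧ Q (y ∷ t)))

  countPegs : {n : ℕ} → (Fin p → Bool) → (ℕ → Bool) → State p n → ℕ
  countPegs F τ s = countFin (λ k → F k ∧ τ (discsOn s k))

  occupiedOn emptyOn crowdedOn : {n : ℕ} → (Fin p → Bool) → State p n → ℕ
  occupiedOn F = countPegs F (0 <ᵇ_)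
  emptyOn    F = countPegs F (_≡ᵇ 0)
  crowdedOn  F = countPegs F (1 <ᵇ_)

  countPegs-cons : {n : ℕ} (F : Fin p → Bool) (τ : ℕ → Bool) (x : Fin p) (s : State p n) →
    countPegs F τ (x ∷ s) ≡ χ (F x ∧ τ (suc (discsOn s x))) + countPegs (F ∖ x) τ s
  countPegs-cons F τ x s = begin
    countPegs F τ (x ∷ s)
      ≡⟨ countFin-pick x (λ k → F k ∧ τ (discsOn (x ∷ s) k)) ⟩
    χ (F x ∧ τ (discsOn (x ∷ s) x)) + countFin (λ k → (F k ∧ τ (discsOn (x ∷ s) k)) ∧ not (x == k))
      ≡⟨ cong₂ _+_ (cong (λ m → χ (F x ∧ τ m)) discsOn-self) (sum-cong-≗ (cong χ ∘ off-x)) ⟩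
    χ (F x ∧ τ (suc (discsOn s x))) + countPegs (F ∖ x) τ s ∎
    where
    open ≡-Reasoning
    discsOn-self : discsOn (x ∷ s) x ≡ suc (discsOn s x)
    discsOn-self = trans (discsOn-cons x s x) (cong (λ b → χ b + discsOn s x) (==-refl x))
    off-x : ∀ k → ((F k ∧ τ (discsOn (x ∷ s) k)) ∧ not (x == k)) ≡ ((F k ∧ not (x == k)) ∧ τ (discsOn s k))
    off-x k rewrite discsOn-cons x s k with x == k
    ... | true  = trans (∧-zeroʳ _) (cong (_∧ τ (discsOn s k)) (sym (∧-zeroʳ (F k))))
    ... | false = trans (∧-identityʳ _) (cong (_∧ τ (discsOn s k)) (sym (∧-identityʳ (F k))))

  occupiedOn-cons : {n : ℕ} (F : Fin p → Bool) (x : Fin p) (s : State p n) →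
    occupiedOn F (x ∷ s) ≡ χ (F x) + occupiedOn (F ∖ x) s
  occupiedOn-cons F x s =
    trans (countPegs-cons F (0 <ᵇ_) x s) (cong (λ b → χ b + occupiedOn (F ∖ x) s) (∧-identityʳ (F x)))

  emptyOn-cons : {n : ℕ} (F : Fin p → Bool) (x : Fin p) (s : State p n) →
    emptyOn F (x ∷ s) ≡ emptyOn (F ∖ x) s
  emptyOn-cons F x s =
    trans (countPegs-cons F (_≡ᵇ 0) x s) (cong (λ b → χ b + emptyOn (F ∖ x) s) (∧-zeroʳ (F x)))

  countPegs-nil : (F : Fin p → Bool) (τ : ℕ → Bool) → τ 0 ≡ false → countPegs F τ [] ≡ 0
  countPegs-nil F τ τ0 = trans (sum-cong-≗ (λ k → cong χ (trans (cong (F k ∧_) τ0) (∧-zeroʳ (F k)))))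
                               (countFin-false {p})

  occupiedOn+emptyOn : {n : ℕ} (F : Fin p → Bool) (s : State p n) → occupiedOn F s + emptyOn F s ≡ countFin F
  occupiedOn+emptyOn F s = countFin-split split
    where
    split : ∀ k → χ (F k ∧ (0 <ᵇ discsOn s k)) + χ (F k ∧ (discsOn s k ≡ᵇ 0)) ≡ χ (F k)
    split k with F k | discsOn s k
    ... | true  | zero  = refl
    ... | true  | suc _ = refl
    ... | false | _     = refl

  count-adjOn : {n : ℕ} (F : Fin p → Bool) (s : State p n) →
    count (adjOn F s) (allStates p n) ≡ occupiedOn F s C 2 + occupiedOn F s * emptyOn F s
  count-adjOn F [] rewrite countPegs-nil F (0 <ᵇ_) refl = refl
  count-adjOn {suc n} F (x ∷ s) = begin
    count (adjOn F (x ∷ s)) (allStates p (suc n))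
      ≡⟨ count-cong (λ t → ∧-identityʳ (adjOn F (x ∷ s) t)) (allStates p (suc n)) ⟨
    count (λ t → adjOn F (x ∷ s) t ∧ true) (allStates p (suc n))
      ≡⟨ count-adjOn-cons F x s (λ _ → true) ⟩
    count (λ t → adjOn (F ∖ x) s t ∧ true) (allStates p n)
      + countFin (λ y → not (x == y) ∧ ((F x ∧ F y) ∧ true))
      ≡⟨ cong₂ _+_ (count-cong (λ t → ∧-identityʳ (adjOn (F ∖ x) s t)) (allStates p n))
                   (trans (sum-cong-≗ (λ y → cong χ (shuffle (not (x == y)) (F x) (F y))))
                          (countFin-∧ˡ (F x) (F ∖ x))) ⟩
    count (adjOn (F ∖ x) s) (allStates p n) + (if F x then countFin (F ∖ x) else 0)
      ≡⟨ cong₂ (λ a b → a + (if F x then b else 0))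
               (count-adjOn (F ∖ x) s) (sym (occupiedOn+emptyOn (F ∖ x) s)) ⟩
    o C 2 + o * e + (if F x then o + e else 0)
      ≡⟨ C2+*-step (F x) o e ⟩
    (χ (F x) + o) C 2 + (χ (F x) + o) * e
      ≡⟨ cong₂ (λ o′ e′ → o′ C 2 + o′ * e′) (occupiedOn-cons F x s) (emptyOn-cons F x s) ⟨
    occupiedOn F (x ∷ s) C 2 + occupiedOn F (x ∷ s) * emptyOn F (x ∷ s) ∎
    where
    open ≡-Reasoning
    o e : ℕ
    o = occupiedOn (F ∖ x) s
    e = emptyOn (F ∖ x) s
    shuffle : ∀ h a b → h ∧ ((a ∧ b) ∧ true) ≡ a ∧ (b ∧ h)
    shuffle = solve 3 (λ h a b → h :* ((a :* b) :* con true) := a :* (b :* h)) refl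
      where open ∨-∧-Solver

module _ {p : ℕ} where

  occ≡occupiedOn : {n : ℕ} (s : State p n) → occ s ≡ occupiedOn allPegs s
  occ≡occupiedOn s = count-tabulate (λ k → 0 <ᵇ discsOn s k) id

  occ-pick : {n : ℕ} (x : Fin p) (s : State p n) → occ s ≡ χ (0 <ᵇ discsOn s x) + occupiedOn (allPegs ∖ x) s
  occ-pick x s = begin
    occ s
      ≡⟨ count-tabulate (λ k → 0 <ᵇ discsOn s k) id ⟩
    countFin (λ k → 0 <ᵇ discsOn s k)
      ≡⟨ countFin-pick x (λ k → 0 <ᵇ discsOn s k) ⟩
    χ (0 <ᵇ discsOn s x) + countFin (λ k → (0 <ᵇ discsOn s k) ∧ not (x == k))
      ≡⟨ cong (χ (0 <ᵇ discsOn s x) +_)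
              (sum-cong-≗ (λ k → cong χ (∧-comm (0 <ᵇ discsOn s k) (not (x == k))))) ⟩
    χ (0 <ᵇ discsOn s x) + occupiedOn (allPegs ∖ x) s ∎
    where open ≡-Reasoning

  occ-cons : {n : ℕ} (x : Fin p) (s : State p n) → occ (x ∷ s) ≡ χ (discsOn s x ≡ᵇ 0) + occ s
  occ-cons x s = begin
    occ (x ∷ s)
      ≡⟨ trans (occ≡occupiedOn (x ∷ s)) (occupiedOn-cons allPegs x s) ⟩
    1 + others
      ≡⟨ new-peg (discsOn s x) ⟩
    χ (discsOn s x ≡ᵇ 0) + (χ (0 <ᵇ discsOn s x) + others)
      ≡⟨ cong (χ (discsOn s x ≡ᵇ 0) +_) (occ-pick x s) ⟨
    χ (discsOn s x ≡ᵇ 0) + occ s ∎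
    where
    open ≡-Reasoning
    others : ℕ
    others = occupiedOn (allPegs ∖ x) s
    new-peg : ∀ d → 1 + others ≡ χ (d ≡ᵇ 0) + (χ (0 <ᵇ d) + others)
    new-peg zero    = refl
    new-peg (suc d) = refl

  occ-<ᵇ-stay : {n : ℕ} (x : Fin p) (s t : State p n) → discsOn s x ≡ discsOn t x →
    (occ (x ∷ s) <ᵇ occ (x ∷ t)) ≡ (occ s <ᵇ occ t)
  occ-<ᵇ-stay x s t same rewrite occ-cons x s | occ-cons x t | same =
    +-cancelˡ-<ᵇ (χ (discsOn t x ≡ᵇ 0)) (occ s) (occ t)

  occ-<ᵇ-move : {n : ℕ} (x y : Fin p) (s : State p n) →
    (occ (x ∷ s) <ᵇ occ (y ∷ s)) ≡ (0 <ᵇ discsOn s x) ∧ (discsOn s y ≡ᵇ 0)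
  occ-<ᵇ-move x y s rewrite occ-cons x s | occ-cons y s
    | +-cancelʳ-<ᵇ (occ s) (χ (discsOn s x ≡ᵇ 0)) (χ (discsOn s y ≡ᵇ 0))
    with discsOn s x | discsOn s y
  ... | zero  | zero  = refl
  ... | zero  | suc _ = refl
  ... | suc _ | zero  = refl
  ... | suc _ | suc _ = refl

  count-adjOn-occ-<ᵇ : {n : ℕ} (F : Fin p → Bool) (s : State p n) →
    count (λ t → adjOn F s t ∧ (occ s <ᵇ occ t)) (allStates p n) ≡ crowdedOn F s * emptyOn F s
  count-adjOn-occ-<ᵇ F [] rewrite countPegs-nil F (1 <ᵇ_) refl = refl
  count-adjOn-occ-<ᵇ {suc n} F (x ∷ s) = begin
    count (λ t → adjOn F (x ∷ s) t ∧ (occ (x ∷ s) <ᵇ occ t)) (allStates p (suc n))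
      ≡⟨ count-adjOn-cons F x s (λ t → occ (x ∷ s) <ᵇ occ t) ⟩
    count (λ t → adjOn (F ∖ x) s t ∧ (occ (x ∷ s) <ᵇ occ (x ∷ t))) (allStates p n)
      + countFin (λ y → not (x == y) ∧ ((F x ∧ F y) ∧ (occ (x ∷ s) <ᵇ occ (y ∷ s))))
      ≡⟨ cong₂ _+_ (count-cong stay (allStates p n))
                   (trans (sum-cong-≗ (λ y → cong χ (move y)))
                          (countFin-∧ˡ c (λ y → (F ∖ x) y ∧ (discsOn s y ≡ᵇ 0)))) ⟩
    count (λ t → adjOn (F ∖ x) s t ∧ (occ s <ᵇ occ t)) (allStates p n) + (if c then e else 0)
      ≡⟨ cong (_+ (if c then e else 0)) (count-adjOn-occ-<ᵇ (F ∖ x) s) ⟩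
    m * e + (if c then e else 0)
      ≡⟨ crowded-step c ⟩
    (χ c + m) * e
      ≡⟨ cong₂ _*_ (countPegs-cons F (1 <ᵇ_) x s) (emptyOn-cons F x s) ⟨
    crowdedOn F (x ∷ s) * emptyOn F (x ∷ s) ∎
    where
    open ≡-Reasoning
    c : Bool
    c = F x ∧ (0 <ᵇ discsOn s x)
    m e : ℕ
    m = crowdedOn (F ∖ x) s
    e = emptyOn (F ∖ x) s
    x-blocked : (F ∖ x) x ≡ false
    x-blocked = trans (cong (λ b → F x ∧ not b) (==-refl x)) (∧-zeroʳ (F x))
    stay : ∀ t → (adjOn (F ∖ x) s t ∧ (occ (x ∷ s) <ᵇ occ (x ∷ t)))
                 ≡ (adjOn (F ∖ x) s t ∧ (occ s <ᵇ occ t))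
    stay t with adjOn (F ∖ x) s t in s~t
    ... | true  = occ-<ᵇ-stay x s t (adjOn-discsOn (F ∖ x) s t x s~t x-blocked)
    ... | false = refl
    move : ∀ y → (not (x == y) ∧ ((F x ∧ F y) ∧ (occ (x ∷ s) <ᵇ occ (y ∷ s))))
                 ≡ c ∧ ((F ∖ x) y ∧ (discsOn s y ≡ᵇ 0))
    move y rewrite occ-<ᵇ-move x y s = shuffle (not (x == y)) (F x) (F y) (0 <ᵇ discsOn s x) (discsOn s y ≡ᵇ 0)
      where
      open ∨-∧-Solver
      shuffle : ∀ h a b u v → h ∧ ((a ∧ b) ∧ (u ∧ v)) ≡ (a ∧ u) ∧ ((b ∧ h) ∧ v)
      shuffle = solve 5 (λ h a b u v → h :* ((a :* b) :* (u :* v)) := (a :* u) :* ((b :* h) :* v)) refl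
    crowded-step : ∀ b → m * e + (if b then e else 0) ≡ (χ b + m) * e
    crowded-step true  = +-comm (m * e) e
    crowded-step false = +-identityʳ (m * e)

-- Degrees, occupancy and the edge count

module _ {p n : ℕ} where

  occ≤p : (s : State p n) → occ s ≤ p
  occ≤p s = subst (_≤ p) (sym (count-tabulate (λ k → 0 <ᵇ discsOn s k) id)) (countFin-≤ _)

  emptyOn-allPegs : (s : State p n) → emptyOn allPegs s ≡ p ∸ occ s
  emptyOn-allPegs s = sym (begin
    p ∸ occ s                                         ≡⟨ cong (_∸ occ s) total ⟨
    occ s + emptyOn allPegs s ∸ occ s                 ≡⟨ m+n∸m≡n (occ s) _ ⟩
    emptyOn allPegs s                                 ∎)
    where
    open ≡-Reasoning
    total : occ s + emptyOn allPegs s ≡ p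
    total = trans (cong (_+ emptyOn allPegs s) (occ≡occupiedOn s))
                  (trans (occupiedOn+emptyOn allPegs s) (countFin-true {p}))

  crowdedOn+singletons : (s : State p n) → crowdedOn allPegs s + singletons s ≡ occ s
  crowdedOn+singletons s = begin
    crowdedOn allPegs s + singletons s
      ≡⟨ cong (crowdedOn allPegs s +_) (count-tabulate (λ k → discsOn s k ≡ᵇ 1) id) ⟩
    countFin (λ k → 1 <ᵇ discsOn s k) + countFin (λ k → discsOn s k ≡ᵇ 1)
      ≡⟨ countFin-split (λ k → split (discsOn s k)) ⟩
    countFin (λ k → 0 <ᵇ discsOn s k)
      ≡⟨ count-tabulate (λ k → 0 <ᵇ discsOn s k) id ⟨
    occ s ∎
    where
    open ≡-Reasoning
    split : ∀ d → χ (1 <ᵇ d) + χ (d ≡ᵇ 1) ≡ χ (0 <ᵇ d)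
    split zero          = refl
    split (suc zero)    = refl
    split (suc (suc _)) = refl

  singletons≤occ : (s : State p n) → singletons s ≤ occ s
  singletons≤occ s = subst (singletons s ≤_) (crowdedOn+singletons s) (m≤n+m _ _)

  crowdedOn-allPegs : (s : State p n) → crowdedOn allPegs s ≡ occ s ∸ singletons s
  crowdedOn-allPegs s =
    sym (trans (cong (_∸ singletons s) (sym (crowdedOn+singletons s))) (m+n∸n≡m _ (singletons s)))

  adj-sym : (u v : State p n) → adj u v ≡ adj v u
  adj-sym u v = trans (adj≡adjOn-allPegs u v) (trans (adjOn-sym allPegs u v) (sym (adj≡adjOn-allPegs v u)))

  deg≡hanoiDegree : (s : State p n) → deg s ≡ hanoiDegree p (occ s)
  deg≡hanoiDegree s = begin
    count (adj s) (allStates p n)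
      ≡⟨ count-cong (adj≡adjOn-allPegs s) (allStates p n) ⟩
    count (adjOn allPegs s) (allStates p n)
      ≡⟨ count-adjOn allPegs s ⟩
    occupiedOn allPegs s C 2 + occupiedOn allPegs s * emptyOn allPegs s
      ≡⟨ cong₂ (λ o e → o C 2 + o * e) (occ≡occupiedOn s) (sym (emptyOn-allPegs s)) ⟨
    hanoiDegree p (occ s) ∎
    where open ≡-Reasoning

  maxDeg≤hanoiDegree : maxDeg p n ≤ hanoiDegree p p
  maxDeg≤hanoiDegree = go (allStates p n)
    where
    go : (ss : List (State p n)) → foldr _⊔_ 0 (map deg ss) ≤ hanoiDegree p p
    go []       = z≤n
    go (s ∷ ss) = ⊔-lub (subst (_≤ hanoiDegree p p) (sym (deg≡hanoiDegree s))
                              (hanoiDegree-mono-≤ (occ≤p s) ≤-refl)) (go ss)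

  upDegree : State p n → ℕ
  upDegree v = count (λ u → adj v u ∧ (occ v <ᵇ occ u)) (allStates p n)

  upDegree≡[occ∸singletons]*[p∸occ] : (v : State p n) → upDegree v ≡ (occ v ∸ singletons v) * (p ∸ occ v)
  upDegree≡[occ∸singletons]*[p∸occ] v = begin
    upDegree v
      ≡⟨ count-cong (λ u → cong (_∧ (occ v <ᵇ occ u)) (adj≡adjOn-allPegs v u)) (allStates p n) ⟩
    count (λ u → adjOn allPegs v u ∧ (occ v <ᵇ occ u)) (allStates p n)
      ≡⟨ count-adjOn-occ-<ᵇ allPegs v ⟩
    crowdedOn allPegs v * emptyOn allPegs v
      ≡⟨ cong₂ _*_ (crowdedOn-allPegs v) (emptyOn-allPegs v) ⟩
    (occ v ∸ singletons v) * (p ∸ occ v) ∎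
    where open ≡-Reasoning

  edgesUp≡sum-upDegree : ∀ {μ} → suc μ < p → μ ≤ p →
    edgesUp p n (hanoiDegree p μ) ≡ sum (map (λ v → if occ v ≡ᵇ μ then upDegree v else 0) (allStates p n))
  edgesUp≡sum-upDegree {μ} sμ<p μ≤p = begin
    sum (map (λ u → count (λ v → E u v) S) S)
      ≡⟨ sum-count-comm E S S ⟩
    sum (map (λ v → count (λ u → E u v) S) S)
      ≡⟨ cong sum (map-cong (λ v → count-cong (λ u → in-occupancies u v) S) S) ⟩
    sum (map (λ v → count (λ u → (adj v u ∧ (occ v <ᵇ occ u)) ∧ (occ v ≡ᵇ μ)) S) S)
      ≡⟨ cong sum (map-cong (λ v → count-∧ʳ (λ u → adj v u ∧ (occ v <ᵇ occ u)) (occ v ≡ᵇ μ) S) S) ⟩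
    sum (map (λ v → if occ v ≡ᵇ μ then upDegree v else 0) S) ∎
    where
    open ≡-Reasoning
    S : List (State p n)
    S = allStates p n
    E : State p n → State p n → Bool
    E u v = adj u v ∧ (deg v <ᵇ deg u) ∧ (deg v ≡ᵇ hanoiDegree p μ)
    in-occupancies : ∀ u v → E u v ≡ (adj v u ∧ (occ v <ᵇ occ u)) ∧ (occ v ≡ᵇ μ)
    in-occupancies u v = begin
      adj u v ∧ (deg v <ᵇ deg u) ∧ (deg v ≡ᵇ hanoiDegree p μ)
        ≡⟨ cong₂ _∧_ (adj-sym u v) (cong₂ (λ dv du → (dv <ᵇ du) ∧ (dv ≡ᵇ hanoiDegree p μ))
                                          (deg≡hanoiDegree v) (deg≡hanoiDegree u)) ⟩
      adj v u ∧ (hanoiDegree p (occ v) <ᵇ hanoiDegree p (occ u)) ∧ (hanoiDegree p (occ v) ≡ᵇ hanoiDegree p μ)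
        ≡⟨ cong (adj v u ∧_) (degree-comparison sμ<p (occ≤p v) (occ≤p u)) ⟩
      adj v u ∧ (occ v <ᵇ occ u) ∧ (occ v ≡ᵇ μ)
        ≡⟨ ∧-assoc (adj v u) _ _ ⟨
      (adj v u ∧ (occ v <ᵇ occ u)) ∧ (occ v ≡ᵇ μ) ∎

  upDegree-at-occ : ∀ μ (v : State p n) →
    (if occ v ≡ᵇ μ then upDegree v else 0) ≡ (if occ v ≡ᵇ μ then (p ∸ μ) * (μ ∸ singletons v) else 0)
  upDegree-at-occ μ v with occ v ≡ᵇ μ in occ≡ᵇμ
  ... | false = refl
  ... | true  rewrite upDegree≡[occ∸singletons]*[p∸occ] v | ≡ᵇ⇒≡ (occ v) μ (subst T (sym occ≡ᵇμ) _) =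
    *-comm (μ ∸ singletons v) (p ∸ μ)

  singletons<suc : ∀ μ (v : State p n) → T (occ v ≡ᵇ μ) → singletons v < suc μ
  singletons<suc μ v occ≡μ = s≤s (subst (singletons v ≤_) (≡ᵇ⇒≡ (occ v) μ occ≡μ) (singletons≤occ v))

hanoiDegree<maxDeg⇒suc< : ∀ {p n μ} → μ ≤ p → hanoiDegree p μ < maxDeg p n → suc μ < p
hanoiDegree<maxDeg⇒suc< {p} {n} {μ} μ≤p λ<Δ with suc μ <? p
... | yes sμ<p = sμ<p
... | no  sμ≮p =
  contradiction (≤-trans (maxDeg≤hanoiDegree {p} {n}) (hanoiDegree-top (≮⇒≥ sμ≮p) μ≤p)) (<⇒≱ λ<Δ)

mainTheorem9 : (p n : ℕ) → 3 ≤ p → (λ' μ : ℕ) → 1 ≤ μ → μ ≤ r p n → f p n μ ≡ λ' →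
    λ' < maxDeg p n → edgesUp p n λ' ≡ rhs p n μ
mainTheorem9 p n _ .(f p n μ) μ _ μ≤r refl λ<Δ = begin
  edgesUp p n (f p n μ)
    ≡⟨ cong (edgesUp p n) λ≡ ⟩
  edgesUp p n (hanoiDegree p μ)
    ≡⟨ edgesUp≡sum-upDegree {p} {n} room μ≤p ⟩
  sum (map (λ v → if occ v ≡ᵇ μ then upDegree v else 0) (allStates p n))
    ≡⟨ cong sum (map-cong (upDegree-at-occ μ) (allStates p n)) ⟩
  sum (map (λ v → if occ v ≡ᵇ μ then weight (singletons v) else 0) (allStates p n))
    ≡⟨ sum-if≡sum-fibres weight (suc μ) (λ v → occ v ≡ᵇ μ) singletons (singletons<suc μ) (allStates p n) ⟩
  rhs p n μ ∎
  where
  open ≡-Reasoning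
  μ≤p : μ ≤ p
  μ≤p = ≤-trans μ≤r (m⊓n≤n n p)
  λ≡ : f p n μ ≡ hanoiDegree p μ
  λ≡ = f≡hanoiDegree n μ≤p
  room : suc μ < p
  room = hanoiDegree<maxDeg⇒suc< {n = n} μ≤p (subst (_< maxDeg p n) λ≡ λ<Δ)
  weight : ℕ → ℕ
  weight ν = (p ∸ μ) * (μ ∸ ν)
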